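{- Let $G$ be a finite Abelian group of exponent $n=q_1^{\alpha_1}\cdots q_\ell^{\alpha_\ell}$ with primes $q_1<\cdots<q_\ell$ and $\alpha_j\geq1$, let $i\in\{1,\dots,\ell\}$ and $d\in\mathcal{A}_i$, and let $S$ be a sequence over $G$. Then $S_d$ contains at least $k_d$ pairwise disjoint non-empty subsequences $S'_1,\dots,S'_{k_d}$ such that, for all $j \in \{1,\dots,k_d\}$, $$\sigma(S'_j) \in G_{q_i^{\nu_{q_i}(n)}} \quad\text{and}\quad \mathsf{k}(S'_j) \leq \frac{1}{\mathrm{ord}(\sigma(S'_j))}.$$
   Context: $G$ is written additively; for $m\mid n$, $G_m=\{x\in G: mx=0\}$. A sequence over $G$ (or over a subset) is a finite multiset of elements; subsequences are sub-multisets, and disjoint subsequences use disjoint terms of $S$; $|S|$ is the length and $\sigma(S)$ the sum. The cross number is $\mathsf{k}(S)=\sum_{g\in S}1/\mathrm{ord}(g)$ (with multiplicity). For $d\mid n$, $S_d$ is the subsequence of $S$ of all elements of order exactly $d$. $P^+(d)$ is the largest prime divisor of $d$ and $\nu_p$ the $p$-adic valuation. $\mathcal{A}_i=\{d\mid n: d>1,\ P^+(d)=q_i\}$. For $d'\mid d\mid n$, $\eta_{(d',d)}(G)$ is the smallest positive integer $t$ such that every sequence over $G_d$ of length at least $t$ contains a non-empty subsequence of length at most $d'$ with sum in $G_{d/d'}$. For $d\in\mathcal{A}_i$ write $m_d=d/q_i^{\nu_{q_i}(d)}$ and let $k_d$ be the smallest non-negative integer such that $|S_d| < k_d\, m_d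 + \eta_{(m_d,d)}(G)$. -}

module Defs where

open import Level using (Level; _⊔_)
open import Algebra.Bundles using (AbelianGroup)
open import Function.Bundles using (Inverse)
open import Data.Nat using (ℕ; zero; suc; _≤_; _<_; _*_; _^_; _+_)
open import Data.Nat.Divisibility using (_∣_)
open import Data.Nat.Primality using (Prime)
open import Data.Fin using (Fin)
import Data.Fin.Properties as FinP
open import Data.List using (List; []; _∷_; foldr; filter; length; _++_)
open import Data.List.Relation.Binary.Permutation.Propositional using (_↭_)
open import Data.List.Relation.Unary.All using (All)
import Data.Product as Σ
open import Data.Product using (Σ; ∃; ∃-syntax; _×_; _,_)
open import Relation.Nullary using (Dec; yes; no; ¬_)
open import Relation.Binary.PropositionalEquality as ≡ using (_≡_)
open import Data.Integer using (+_)
import Data.Rational as ℚ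
open import Relation.Unary using (Pred)
import Data.Nat as ℕ

Finite : ∀ {c ℓ} → AbelianGroup c ℓ → Set (c ⊔ ℓ)
Finite G = Σ ℕ λ N → Inverse (AbelianGroup.setoid G) (≡.setoid (Fin N))

IsValuation : ℕ → ℕ → ℕ → Set
IsValuation p m a = (p ^ a) ∣ m × ¬ ((p ^ suc a) ∣ m)

IsLargestPrimeDivisor : ℕ → ℕ → Set
IsLargestPrimeDivisor q d = Prime q × q ∣ d × (∀ p → Prime p → p ∣ d → p ≤ q)

module GroupDefs {c ℓ} (G : AbelianGroup c ℓ) where
  open AbelianGroup G renaming (_∙_ to _+ᴳ_; ε to 0ᴳ)
  open import Algebra.Definitions.RawMonoid rawMonoid using () renaming (_×_ to _·_)

  σ : List Carrier → Carrier
  σ = foldr _+ᴳ_ 0ᴳ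

  InG : ℕ → Carrier → Set ℓ
  InG m x = (m · x) ≈ 0ᴳ

  IsExponent : ℕ → Set (c ⊔ ℓ)
  IsExponent n = 0 < n × (∀ g → InG n g)
                 × (∀ m → 0 < m → (∀ g → InG m g) → n ≤ m)

  IsSubseq : List Carrier → List Carrier → Set c
  IsSubseq T S = ∃[ R ] (T ++ R) ↭ S

  -- "every sequence over G_d of length ≥ t has a non-empty subsequence of
  -- length ≤ d' with sum in G_{d/d'}"; here e is the cofactor d/d', i.e. d' * e ≡ d.
  ShortSumProperty : (d' e d t : ℕ) → Set (c ⊔ ℓ)
  ShortSumProperty d' e d t =
    ∀ (T : List Carrier) → All (InG d) T → t ≤ length T →
      ∃[ U ] (IsSubseq U T × ¬ (U ≡ []) × length U ≤ d' × InG e (σ U))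

  IsEta : (d' e d t : ℕ) → Set (c ⊔ ℓ)
  IsEta d' e d t = 0 < t × ShortSumProperty d' e d t
                   × (∀ t' → 0 < t' → ShortSumProperty d' e d t' → t ≤ t')

  module WithFinite (fin : Finite G) (n : ℕ) where
    _≈?_ : (x y : Carrier) → Dec (x ≈ y)
    x ≈? y with Σ.proj₂ fin | FinP._≟_ (Inverse.to (Σ.proj₂ fin) x) (Inverse.to (Σ.proj₂ fin) y)
    ... | inv | yes eq = yes (trans (sym (Inverse.strictlyInverseʳ inv x))
                               (trans (Inverse.from-cong inv eq) (Inverse.strictlyInverseʳ inv y)))
    ... | inv | no ne = no (λ x≈y → ne (Inverse.to-cong inv x≈y))

    -- search: returns m with ord g = suc m, i.e. the least k ≥ suc m0 (within fuel) with k·g = 0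
    ordSearch : ℕ → ℕ → Carrier → ℕ
    ordSearch zero m g = m
    ordSearch (suc f) m g with (suc m · g) ≈? 0ᴳ
    ... | yes _ = m
    ... | no _  = ordSearch f (suc m) g

    -- ord(g): the least positive k with k g = 0 (it is ≤ n, the exponent of G)
    ord : Carrier → ℕ
    ord g = suc (ordSearch n 0 g)

    seqOfOrder : ℕ → List Carrier → List Carrier
    seqOfOrder d = filter (λ g → ord g ℕ.≟ d)

    crossNumber : List Carrier → ℚ.ℚ
    crossNumber = foldr (λ g r → ((+ 1) ℚ./ ord g) ℚ.+ r) ℚ.0ℚ

    invOrd : Carrier → ℚ.ℚ
    invOrd x = (+ 1) ℚ./ ord x

IsLeastK : (len m t k : ℕ) → Set
IsLeastK len m t k = len < k * m + t × (∀ k' → len < k' * m + t → k ≤ k')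

-- Split off, one after another, short subsequences of S_d whose sums lie in G_{q^a}
-- (d = m q^a): while at least η_{(m,d)}(G) terms are left, the defining property of
-- η produces such a subsequence of length ≤ m, and each costs at most m terms, so
-- k_d of them are obtained.  A piece U has all its terms of order d, hence
-- k(U) = |U|/d ≤ m/d = 1/q^a ≤ 1/ord(σ U), and σ U ∈ G_{q^a} ⊆ G_{q^ν_q(n)}.
module Submission where

open import Defs
open import Level using (Level)
open import Algebra.Bundles using (AbelianGroup)
open import Data.Nat as ℕ using (ℕ; zero; suc; _<_; _*_; _^_; _≤_; _+_; _∸_)
import Data.Nat.Properties as ℕP
open import Data.Nat.Divisibility using (_∣_; divides; ∣-trans; ∣⇒≤; m∣m*n)
open import Data.Nat.Primality using (prime⇒nonZero)
open import Data.Fin using (Fin)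
open import Data.Vec using (lookup; toList; []; _∷_)
open import Data.List using (List; []; _∷_; _++_; concat; length)
import Data.List.Properties as ListP
open import Data.List.Relation.Binary.Permutation.Propositional using (_↭_; ↭-trans; ↭-sym; ↭-refl)
import Data.List.Relation.Binary.Permutation.Propositional.Properties as PermP
open import Data.List.Relation.Unary.All as All using (All; _∷_; [])
import Data.List.Relation.Unary.All.Properties as AllP
import Data.Vec.Relation.Unary.All as VecAll
import Data.Vec.Relation.Unary.All.Properties as VecAllP
open import Data.Product using (∃-syntax; _×_; _,_)
open import Data.Sum using (_⊎_; inj₁; inj₂)
open import Relation.Nullary using (¬_; yes; no)
open import Relation.Unary using (Pred; _⊆_)
open import Relation.Binary.PropositionalEquality as ≡ using (_≡_; refl)
open import Data.Empty using (⊥-elim)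
open import Data.Integer as ℤ using (+_)
import Data.Integer.Properties as ℤP
import Data.Rational as ℚ
import Data.Rational.Properties as ℚP
open import Data.Rational.Unnormalised as ℚᵘ using (mkℚᵘ; *≡*; *≤*)
import Data.Rational.Unnormalised.Properties as ℚᵘP
open import Data.Nat.Tactic.RingSolver using (solve-∀)

^-monoʳ-∣ : ∀ q {a b} → a ≤ b → q ^ a ∣ q ^ b
^-monoʳ-∣ q {a} {b} a≤b =
  ≡.subst (q ^ a ∣_)
    (≡.trans (≡.sym (ℕP.^-distribˡ-+-* q a (b ∸ a))) (≡.cong (q ^_) (ℕP.m+[n∸m]≡n a≤b)))
    (m∣m*n (q ^ (b ∸ a)))

valuation-maximal : ∀ {q n a b} → q ^ a ∣ n → IsValuation q n b → a ≤ b
valuation-maximal {q} qᵃ∣n (_ , qᵇ⁺¹∤n) =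
  ℕP.≮⇒≥ (λ b<a → qᵇ⁺¹∤n (∣-trans (^-monoʳ-∣ q b<a) qᵃ∣n))

-- mkℚᵘ p e is the fraction p / (1 + e).

[1+a]/d≃1/d+a/d : ∀ a e → mkℚᵘ (+ 1) e ℚᵘ.+ mkℚᵘ (+ a) e ℚᵘ.≃ mkℚᵘ (+ suc a) e
[1+a]/d≃1/d+a/d a e = *≡* (begin
    (+ 1 ℤ.* + D ℤ.+ + a ℤ.* + D) ℤ.* + D
      ≡⟨ ≡.cong₂ (λ x y → (x ℤ.+ y) ℤ.* + D) (≡.sym (ℤP.pos-* 1 D)) (≡.sym (ℤP.pos-* a D)) ⟩
    + (1 * D + a * D) ℤ.* + D   ≡⟨ ≡.sym (ℤP.pos-* (1 * D + a * D) D) ⟩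
    + ((1 * D + a * D) * D)      ≡⟨ ≡.cong +_ (distrib D a) ⟩
    + (suc a * (D * D))          ≡⟨ ℤP.pos-* (suc a) (D * D) ⟩
    + suc a ℤ.* + (D * D)        ∎)
  where
  open ≡.≡-Reasoning
  D = suc e
  distrib : ∀ D a → (1 * D + a * D) * D ≡ suc a * (D * D)
  distrib = solve-∀

a/d≤1/o : ∀ a e o → a * suc o ≤ suc e → mkℚᵘ (+ a) e ℚᵘ.≤ mkℚᵘ (+ 1) o
a/d≤1/o a e o a*o≤d =
  *≤* (≡.subst₂ ℤ._≤_ (ℤP.pos-* a (suc o)) (ℤP.pos-* 1 (suc e))
        (ℤ.+≤+ (ℕP.≤-trans a*o≤d (ℕP.≤-reflexive (≡.sym (ℕP.*-identityˡ (suc e)))))))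

toℚᵘ-1/[1+e] : ∀ e → ℚ.toℚᵘ ((+ 1) ℚ./ suc e) ℚᵘ.≃ mkℚᵘ (+ 1) e
toℚᵘ-1/[1+e] e = ℚP.toℚᵘ-fromℚᵘ (mkℚᵘ (+ 1) e)

module _ {c ℓ} (G : AbelianGroup c ℓ) where
  open AbelianGroup G using (Carrier; _≈_; identityˡ; monoid; rawMonoid)
    renaming (ε to 0ᴳ; refl to ≈-refl; trans to ≈-trans; sym to ≈-sym)
  open import Algebra.Properties.Monoid.Mult monoid using (×-assocˡ; ×-congʳ)
  open import Algebra.Definitions.RawMonoid rawMonoid using () renaming (_×_ to _·_)
  open GroupDefs G

  ·-zeroʳ : ∀ k → (k · 0ᴳ) ≈ 0ᴳ
  ·-zeroʳ zero    = ≈-refl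
  ·-zeroʳ (suc k) = ≈-trans (identityˡ _) (·-zeroʳ k)

  InG-∣ : ∀ {x y g} → x ∣ y → InG x g → InG y g
  InG-∣ {x} {g = g} (divides k refl) xg≈0 =
    ≈-trans (≈-sym (×-assocˡ g k x)) (≈-trans (×-congʳ k xg≈0) (·-zeroʳ k))

  ShortSum : (m e : ℕ) → Pred (List Carrier) _
  ShortSum m e U = ¬ U ≡ [] × length U ≤ m × InG e (σ U)

  module _ {p} {P : Pred Carrier p} {m e d t : ℕ}
           (short : ShortSumProperty m e d t) (P⊆G_d : P ⊆ InG d) where

    Piece : Pred (List Carrier) _
    Piece U = All P U × ShortSum m e U

    splitOffShortSum : ∀ {T} → All P T → t ≤ length T →
      ∃[ U ] ∃[ R ] ((U ++ R) ↭ T × Piece U × All P R × length T ≡ length U + length R)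
    splitOffShortSum {T} pT t≤|T| =
      let (U , (R , U++R↭T) , U≢[] , |U|≤m , σU∈G) = short T (All.map P⊆G_d pT) t≤|T|
          pU++R = PermP.All-resp-↭ (↭-sym U++R↭T) pT
      in  U , R , U++R↭T , (AllP.++⁻ˡ U pU++R , U≢[] , |U|≤m , σU∈G) , AllP.++⁻ʳ U pU++R
          , ≡.trans (≡.sym (PermP.↭-length U++R↭T)) (ListP.length-++ U)

    disjointShortSums : ∀ j {T} → All P T → j * m + t ≤ length T →
      ∃[ Ts ] ∃[ R ] ((concat (toList {n = suc j} Ts) ++ R) ↭ T × VecAll.All Piece Ts)
    disjointShortSums zero {T} pT t≤|T| =
      let (U , R , U++R↭T , pieceU , _) = splitOffShortSum pT t≤|T|
      in  U ∷ [] , R , ≡.subst (λ V → (V ++ R) ↭ T) (≡.sym (ListP.++-identityʳ U)) U++R↭T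
          , pieceU VecAll.∷ VecAll.[]
    disjointShortSums (suc j) {T} pT bound =
      let (U , R , U++R↭T , pieceU , pR , |T|≡) =
            splitOffShortSum pT (ℕP.≤-trans (ℕP.m≤n+m t (suc j * m)) bound)
          (Ts , R′ , Ts++R′↭R , pieces) =
            disjointShortSums j pR (enoughLeft {U} {R} (piece-length≤m pieceU) |T|≡)
      in  U ∷ Ts , R′
          , ↭-trans (PermP.++-assoc U (concat (toList Ts)) R′) (↭-trans (PermP.++⁺ˡ U Ts++R′↭R) U++R↭T)
          , pieceU VecAll.∷ pieces
      where
      piece-length≤m : ∀ {U} → Piece U → length U ≤ m
      piece-length≤m (_ , _ , |U|≤m , _) = |U|≤m
      enoughLeft : ∀ {U R} → length U ≤ m → length T ≡ length U + length R → j * m + t ≤ length R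
      enoughLeft {U} {R} |U|≤m |T|≡ = ℕP.+-cancelˡ-≤ m _ _ (begin
        m + (j * m + t)   ≡⟨ ℕP.+-assoc m (j * m) t ⟨
        suc j * m + t     ≤⟨ bound ⟩
        length T          ≡⟨ |T|≡ ⟩
        length U + length R ≤⟨ ℕP.+-monoˡ-≤ (length R) |U|≤m ⟩
        m + length R      ∎)
        where open ℕP.≤-Reasoning

  module _ (fin : Finite G) (n : ℕ) where
    open WithFinite fin n

    ordSearch-exhausted-or-annihilates : ∀ f m g →
      ordSearch f m g ≡ m + f ⊎ InG (suc (ordSearch f m g)) g
    ordSearch-exhausted-or-annihilates zero m g = inj₁ (≡.sym (ℕP.+-identityʳ m))
    ordSearch-exhausted-or-annihilates (suc f) m g with (suc m · g) ≈? 0ᴳ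
    ... | yes m+1∈G = inj₂ m+1∈G
    ... | no _ with ordSearch-exhausted-or-annihilates f (suc m) g
    ...   | inj₁ exhausted = inj₁ (≡.trans exhausted (≡.sym (ℕP.+-suc m f)))
    ...   | inj₂ annihilates = inj₂ annihilates

    ordSearch-least : ∀ f m g k → m < k → k ≤ m + f → InG k g → ordSearch f m g < k
    ordSearch-least zero m g k m<k k≤m+0 _ =
      ⊥-elim (ℕP.<⇒≱ m<k (ℕP.≤-trans k≤m+0 (ℕP.≤-reflexive (ℕP.+-identityʳ m))))
    ordSearch-least (suc f) m g k m<k k≤m+f+1 k∈G with (suc m · g) ≈? 0ᴳ
    ... | yes _ = m<k
    ... | no m+1∉G with suc m ℕ.≟ k
    ...   | yes refl = ⊥-elim (m+1∉G k∈G)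
    ...   | no m+1≢k = ordSearch-least f (suc m) g k (ℕP.≤∧≢⇒< m<k m+1≢k)
                         (ℕP.≤-trans k≤m+f+1 (ℕP.≤-reflexive (ℕP.+-suc m f))) k∈G

    ord≤n⇒InG-ord : ∀ g → ord g ≤ n → InG (ord g) g
    ord≤n⇒InG-ord g ord≤n with ordSearch-exhausted-or-annihilates n 0 g
    ... | inj₁ exhausted = ⊥-elim (ℕP.<⇒≱ (ℕP.≤-reflexive (≡.cong suc (≡.sym exhausted))) ord≤n)
    ... | inj₂ annihilates = annihilates

    ord-least : ∀ g k → 0 < k → k ≤ n → InG k g → ord g ≤ k
    ord-least g k = ordSearch-least n 0 g k

    crossNumber-ofOrder : ∀ e {U} → All (λ g → ord g ≡ suc e) U →
      ℚ.toℚᵘ (crossNumber U) ℚᵘ.≃ mkℚᵘ (+ length U) e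
    crossNumber-ofOrder e [] = *≡* refl
    crossNumber-ofOrder e {g ∷ U} (ord-g ∷ ord-U) =
      ℚᵘP.≃-trans (ℚP.toℚᵘ-homo-+ (invOrd g) (crossNumber U))
        (ℚᵘP.≃-trans (ℚᵘP.+-cong invOrd-g (crossNumber-ofOrder e ord-U))
                     ([1+a]/d≃1/d+a/d (length U) e))
      where
      invOrd-g : ℚ.toℚᵘ (invOrd g) ℚᵘ.≃ mkℚᵘ (+ 1) e
      invOrd-g rewrite ℕP.suc-injective ord-g = toℚᵘ-1/[1+e] e

    crossNumber≤invOrd : ∀ {d U} x → 0 < d → All (λ g → ord g ≡ d) U →
      length U * ord x ≤ d → crossNumber U ℚ.≤ invOrd x
    crossNumber≤invOrd {suc e} {U} x _ ord-U |U|*ord≤d =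
      ℚP.toℚᵘ-cancel-≤
        (ℚᵘP.≤-respˡ-≃ (ℚᵘP.≃-sym (crossNumber-ofOrder e ord-U))
          (ℚᵘP.≤-respʳ-≃ (ℚᵘP.≃-sym (toℚᵘ-1/[1+e] (ordSearch n 0 x)))
            (a/d≤1/o (length U) e (ordSearch n 0 x) |U|*ord≤d)))

    shortSum-crossNumber≤invOrd : ∀ {m e d U} → m * e ≡ d → 0 < d → 0 < e → e ≤ n →
      All (λ g → ord g ≡ d) U → ShortSum m e U → crossNumber U ℚ.≤ invOrd (σ U)
    shortSum-crossNumber≤invOrd {U = U} m*e≡d 0<d 0<e e≤n ord-U (_ , |U|≤m , σU∈G) =
      crossNumber≤invOrd (σ U) 0<d ord-U
        (ℕP.≤-trans (ℕP.*-mono-≤ |U|≤m (ord-least (σ U) _ 0<e e≤n σU∈G)) (ℕP.≤-reflexive m*e≡d))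

corollary12 : ∀ {c ℓ : Level} (G : AbelianGroup c ℓ) (fin : Finite G) (n : ℕ)
    → GroupDefs.IsExponent G n
    → (q d : ℕ) → d ∣ n → 1 < d → IsLargestPrimeDivisor q d
    → (a b m : ℕ) → IsValuation q d a → IsValuation q n b → m * q ^ a ≡ d
    → (S : List (AbelianGroup.Carrier G))
    → (t : ℕ) → GroupDefs.IsEta G m (q ^ a) d t
    → (k : ℕ) → IsLeastK (length (GroupDefs.WithFinite.seqOfOrder G fin n d S)) m t k
    → ∃[ Ts ] ∃[ R ]
        ((concat (toList Ts) ++ R) ↭ GroupDefs.WithFinite.seqOfOrder G fin n d S
        × (∀ (j : Fin k) →
             ¬ (lookup Ts j ≡ [])
             × GroupDefs.InG G (q ^ b) (GroupDefs.σ G (lookup Ts j))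
             × (GroupDefs.WithFinite.crossNumber G fin n (lookup Ts j)
                 ℚ.≤ GroupDefs.WithFinite.invOrd G fin n (GroupDefs.σ G (lookup Ts j)))))
corollary12 G fin n _ q d _ _ _ a b m _ _ _ S t _ zero _ =
  [] , GroupDefs.WithFinite.seqOfOrder G fin n d S , ↭-refl , λ ()
corollary12 G fin n (n>0 , _) q d d∣n 1<d (q-prime , _) a b m (qᵃ∣d , _) νₙq≡b mqᵃ≡d S t (_ , short , _)
            (suc j) (_ , least) =
  let (Ts , R , Ts++R↭S_d , pieces) =
        disjointShortSums G {P = λ g → ord g ≡ d} {m} {q ^ a} {d} {t} short G_d-ofOrder j
          (AllP.all-filter (λ g → ord g ℕ.≟ d) S) enough
  in  Ts , R , Ts++R↭S_d , λ i → properties (VecAllP.lookup⁺ pieces i)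
  where
  open GroupDefs G
  open WithFinite fin n
  instance _ = prime⇒nonZero q-prime
  instance _ = ℕ.>-nonZero n>0
  d≤n = ∣⇒≤ d∣n
  qᵃ∣n = ∣-trans qᵃ∣d d∣n
  a≤b : a ≤ b
  a≤b = valuation-maximal qᵃ∣n νₙq≡b
  G_d-ofOrder : ∀ {g} → ord g ≡ d → InG d g
  G_d-ofOrder {g} refl = ord≤n⇒InG-ord G fin n g d≤n
  enough : j * m + t ≤ length (seqOfOrder d S)
  enough = ℕP.≮⇒≥ (λ short-of → ℕP.<-irrefl refl (least j short-of))
  properties : ∀ {U} → All (λ g → ord g ≡ d) U × ShortSum G m (q ^ a) U →
    ¬ U ≡ [] × InG (q ^ b) (σ U) × crossNumber U ℚ.≤ invOrd (σ U)
  properties {U} (ord-U , shortSum@(U≢[] , _ , σU∈G)) =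
    U≢[] , InG-∣ G (^-monoʳ-∣ q a≤b) σU∈G
    , shortSum-crossNumber≤invOrd G fin n mqᵃ≡d (ℕP.<-trans ℕP.0<1+n 1<d) (ℕP.m^n>0 q a) (∣⇒≤ qᵃ∣n) ord-U shortSum
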